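{- Let $A,B$ be non-empty sets, $I$ a non-empty index set, $\{V_i\}_{i\in I}\subseteq\mathcal{R}(A)$, $\{W_i\}_{i\in I}\subseteq\mathcal{R}(B)$, $\mathcal{A}=(A,I,V_i)$, $\mathcal{B}=(B,I,W_i)$. Let $R\in\mathcal{R}(A,B)$ be a uniform fuzzy relation and $Z\in\mathcal{R}(A,B)$ a fuzzy relation with $R\le Z$. Then $R$ is a solution to $WL^{2\text{ - }5}(A,B,I,V_i,W_i,Z)$ if and only if all of the following hold: (i) $E_A^R$ is a solution to $WL^{1\text{ - }4}(A,I,V_i,Z\circ Z^{ -1})$; (ii) $E_B^R$ is a solution to $WL^{1\text{ - }5}(B,I,W_i,Z^{ -1}\circ Z)$; (iii) $\widetilde R$ is an isomorphism of the quotient fuzzy relational systems $\mathcal{A}/E_A^R$ and $\mathcal{B}/E_B^R$.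
   Context: $\mathcal{L}=(L,\wedge,\vee,\otimes,\to,0,1)$ is a complete residuated lattice; $x\leftrightarrow y=(x\to y)\wedge(y\to x)$. $\mathcal{R}(X,Y)$: fuzzy relations $X\times Y\to L$ ordered pointwise, $\mathcal{R}(X)=\mathcal{R}(X,X)$; $R^{ -1}(y,x)=R(x,y)$; $(R\circ S)(x,z)=\bigvee_y R(x,y)\otimes S(y,z)$. Kernel and co-kernel of $R\in\mathcal{R}(A,B)$: $E_A^R(a_1,a_2)=\bigwedge_{b}(R(a_1,b)\leftrightarrow R(a_2,b))$, $E_B^R(b_1,b_2)=\bigwedge_a(R(a,b_1)\leftrightarrow R(a,b_2))$ (fuzzy equivalences). $R$ is a partial fuzzy function if $R(a_1,b)\otimes E_A^R(a_1,a_2)\le R(a_2,b)$, $R(a,b_1)\otimes E_B^R(b_1,b_2)\le R(a,b_2)$ and $R(a,b_1)\otimes R(a,b_2)\le E_B^R(b_1,b_2)$; it is a uniform fuzzy relation if moreover each $a$ has some $b$ with $R(a,b)=1$ and each $b$ has some $a$ with $R(a,b)=1$. For a fuzzy equivalence $E$ on $X$, $E_x(y)=E(x,y)$ and $X/E=\{E_x:x\in X\}$. For uniform $R$ with $E=E_A^R$, $F=E_B^R$, the map $\widetilde R:A/E\to B/F$ is $\widetilde R(E_a)=F_{\psi(a)}$, where $\psi:A\to B$ is any function with $R(a,\psi(a))=1$ for all $a$ (well defined, independent of $\psi$, bijective). A fuzzy relational system is $(X,I,T_i)$ with $T_i\in\mathcal{R}(X)$; its quotient by a fuzzy equivalence $E$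 is $(X/E,I,T_i^{X/E})$ with $T_i^{X/E}(E_{x_1},E_{x_2})=(E\circ T_i\circ E)(x_1,x_2)$. An isomorphism $(X,I,T_i)\to(Y,I,S_i)$ is a bijection $\varphi$ with $T_i(x_1,x_2)=S_i(\varphi(x_1),\varphi(x_2))$ for all $x_1,x_2,i$. $WL^{2\text{ - }5}(A,B,I,V_i,W_i,Z)$ (unknown $U\in\mathcal{R}(A,B)$): $V_i\circ U=U\circ W_i$ ($i\in I$), $U\le Z$. $WL^{1\text{ - }4}(X,I,T_i,W)$ (unknown $U\in\mathcal{R}(X)$): $U\circ T_i\le T_i\circ U$, $U^{ -1}\circ T_i\le T_i\circ U^{ -1}$ ($i\in I$), $U\le W$, $U^{ -1}\le W$. $WL^{1\text{ - }5}(X,I,T_i,W)$: $T_i\circ U\le U\circ T_i$, $T_i\circ U^{ -1}\le U^{ -1}\circ T_i$ ($i\in I$), $U\le W$, $U^{ -1}\le W$. -}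

module Defs where

open import Level using (0ℓ)
open import Data.Product using (Σ; _×_; _,_; proj₁; ∃-syntax)
open import Relation.Binary.PropositionalEquality using (_≡_)

record CompleteResiduatedLattice : Set₁ where
  infixr 6 _∨_
  infixr 7 _∧_
  infixr 7 _⊗_
  infixr 5 _⇒_
  infix 4 _≤_
  field
    Carrier : Set
    _≤_ : Carrier → Carrier → Set
    ≤-refl : ∀ {x} → x ≤ x
    ≤-trans : ∀ {x y z} → x ≤ y → y ≤ z → x ≤ z
    ≤-antisym : ∀ {x y} → x ≤ y → y ≤ x → x ≡ y
    _∧_ _∨_ : Carrier → Carrier → Carrier
    ∧-lb₁ : ∀ x y → x ∧ y ≤ x
    ∧-lb₂ : ∀ x y → x ∧ y ≤ y
    ∧-glb : ∀ {x y z} → z ≤ x → z ≤ y → z ≤ x ∧ y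
    ∨-ub₁ : ∀ x y → x ≤ x ∨ y
    ∨-ub₂ : ∀ x y → y ≤ x ∨ y
    ∨-lub : ∀ {x y z} → x ≤ z → y ≤ z → x ∨ y ≤ z
    𝟘 𝟙 : Carrier
    𝟘-min : ∀ x → 𝟘 ≤ x
    𝟙-max : ∀ x → x ≤ 𝟙
    ⋀ ⋁ : {J : Set} → (J → Carrier) → Carrier
    ⋀-lb : ∀ {J : Set} (f : J → Carrier) (j : J) → ⋀ f ≤ f j
    ⋀-glb : ∀ {J : Set} (f : J → Carrier) {z} → (∀ j → z ≤ f j) → z ≤ ⋀ f
    ⋁-ub : ∀ {J : Set} (f : J → Carrier) (j : J) → f j ≤ ⋁ f
    ⋁-lub : ∀ {J : Set} (f : J → Carrier) {z} → (∀ j → f j ≤ z) → ⋁ f ≤ z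
    _⊗_ : Carrier → Carrier → Carrier
    ⊗-assoc : ∀ x y z → (x ⊗ y) ⊗ z ≡ x ⊗ (y ⊗ z)
    ⊗-comm : ∀ x y → x ⊗ y ≡ y ⊗ x
    ⊗-identityˡ : ∀ x → 𝟙 ⊗ x ≡ x
    _⇒_ : Carrier → Carrier → Carrier
    adj₁ : ∀ {x y z} → x ⊗ y ≤ z → x ≤ y ⇒ z
    adj₂ : ∀ {x y z} → x ≤ y ⇒ z → x ⊗ y ≤ z

  _⇔_ : Carrier → Carrier → Carrier
  x ⇔ y = (x ⇒ y) ∧ (y ⇒ x)

module FuzzyRel (L : CompleteResiduatedLattice) where
  open CompleteResiduatedLattice L

  Rel : Set → Set → Set
  Rel X Y = X → Y → Carrier

  _⊑_ : ∀ {X Y} → Rel X Y → Rel X Y → Set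
  R ⊑ S = ∀ x y → R x y ≤ S x y
  infix 4 _⊑_

  _≐_ : ∀ {X Y} → Rel X Y → Rel X Y → Set
  R ≐ S = ∀ x y → R x y ≡ S x y
  infix 4 _≐_

  _⁻¹ : ∀ {X Y} → Rel X Y → Rel Y X
  (R ⁻¹) y x = R x y

  _∘_ : ∀ {X Y Z} → Rel X Y → Rel Y Z → Rel X Z
  (R ∘ S) x z = ⋁ (λ y → R x y ⊗ S y z)
  infixl 9 _∘_

  kerA : ∀ {A B} → Rel A B → Rel A A
  kerA R a₁ a₂ = ⋀ (λ b → R a₁ b ⇔ R a₂ b)

  kerB : ∀ {A B} → Rel A B → Rel B B
  kerB R b₁ b₂ = ⋀ (λ a → R a b₁ ⇔ R a b₂)

  IsPartialFuzzyFunction : ∀ {A B} → Rel A B → Set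
  IsPartialFuzzyFunction {A} {B} R =
    (∀ (a₁ a₂ : A) (b : B) → R a₁ b ⊗ kerA R a₁ a₂ ≤ R a₂ b) ×
    (∀ (a : A) (b₁ b₂ : B) → R a b₁ ⊗ kerB R b₁ b₂ ≤ R a b₂) ×
    (∀ (a : A) (b₁ b₂ : B) → R a b₁ ⊗ R a b₂ ≤ kerB R b₁ b₂)

  -- uniform fuzzy relation (existence given by explicit witnesses)
  record IsUniform {A B : Set} (R : Rel A B) : Set where
    field
      partial : IsPartialFuzzyFunction R
      left    : ∀ (a : A) → Σ B (λ b → R a b ≡ 𝟙)
      right   : ∀ (b : B) → Σ A (λ a → R a b ≡ 𝟙)

    ψ : A → B
    ψ a = proj₁ (left a)

  WL2-5 : ∀ {A B I : Set} → (I → Rel A A) → (I → Rel B B) → Rel A B → Rel A B → Set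
  WL2-5 V W Z U = (∀ i → V i ∘ U ≐ U ∘ W i) × U ⊑ Z

  WL1-4 : ∀ {X I : Set} → (I → Rel X X) → Rel X X → Rel X X → Set
  WL1-4 T W U =
    (∀ i → U ∘ T i ⊑ T i ∘ U) × (∀ i → (U ⁻¹) ∘ T i ⊑ T i ∘ (U ⁻¹)) ×
    U ⊑ W × (U ⁻¹) ⊑ W

  WL1-5 : ∀ {X I : Set} → (I → Rel X X) → Rel X X → Rel X X → Set
  WL1-5 T W U =
    (∀ i → T i ∘ U ⊑ U ∘ T i) × (∀ i → T i ∘ (U ⁻¹) ⊑ (U ⁻¹) ∘ T i) ×
    U ⊑ W × (U ⁻¹) ⊑ W

  -- Quotient X/E represented by X, classes E_x compared extensionally:
  -- E_x = E_x' iff ∀ y, E x y = E x' y.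
  SameClass : ∀ {X : Set} → Rel X X → X → X → Set
  SameClass E x x' = ∀ y → E x y ≡ E x' y

  -- φ : X → Y induces the map X/E → Y/F, E_x ↦ F_{φ x}.
  record IsQuotientIso {X Y I : Set} (T : I → Rel X X) (E : Rel X X)
                       (S : I → Rel Y Y) (F : Rel Y Y) (φ : X → Y) : Set where
    field
      well-defined : ∀ x x' → SameClass E x x' → SameClass F (φ x) (φ x')
      injective    : ∀ x x' → SameClass F (φ x) (φ x') → SameClass E x x'
      surjective   : ∀ (y : Y) → Σ X (λ x → SameClass F (φ x) y)
      preserves    : ∀ (i : I) (x₁ x₂ : X) →
                       (E ∘ T i ∘ E) x₁ x₂ ≡ (F ∘ S i ∘ F) (φ x₁) (φ x₂)

module Submission where

-- For a uniform R with kernel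
-- E = kerA R and co-kernel F = kerB R one has R ∘ R⁻¹ = E, R⁻¹ ∘ R = F,
-- E ∘ R = R = R ∘ F, E and F are fuzzy equivalences, and R a c = F (ψ a) c.
-- With these identities the WL^{2-5} equation V ∘ R = R ∘ W is equivalent to
-- the three "sandwich" identities
--     E ∘ V ∘ E = V ∘ E,   E ∘ V ∘ E = R ∘ W ∘ R⁻¹,   F ∘ W ∘ F = F ∘ W,
-- and each of them is one of the conditions of the theorem:
--   * for a reflexive transitive E, E ∘ V ⊑ V ∘ E iff E ∘ V ∘ E = V ∘ E
--     (dually for F), which with symmetry of E, F gives WL^{1-4} and WL^{1-5};
--   * since R ∘ S ∘ R⁻¹ is F ∘ S ∘ F read through ψ, the second identity says
--     that the bijection A/E → B/F induced by ψ preserves the quotient relations.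

open import Defs
open import Data.Product using (_×_; _,_; proj₁; proj₂; Σ)
open import Function.Bundles using (_⇔_; mk⇔; Equivalence)
open import Relation.Binary.Bundles using (Preorder)
open import Relation.Binary.PropositionalEquality as ≡ using (_≡_; refl; cong; cong₂)
import Relation.Binary.Reasoning.Preorder as PreorderReasoning

module LatticeFacts (L : CompleteResiduatedLattice) where
  open CompleteResiduatedLattice L renaming (_⇔_ to _⟺_)

  ≡⇒≤ : ∀ {x y} → x ≡ y → x ≤ y
  ≡⇒≤ refl = ≤-refl

  ≤-preorder : Preorder _ _ _
  ≤-preorder = record
    { Carrier = Carrier ; _≈_ = _≡_ ; _≲_ = _≤_
    ; isPreorder = record
      { isEquivalence = ≡.isEquivalence ; reflexive = ≡⇒≤ ; trans = ≤-trans } }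

  module ≤-Reasoning = PreorderReasoning ≤-preorder

  ⊗-identityʳ : ∀ x → x ⊗ 𝟙 ≡ x
  ⊗-identityʳ x = ≡.trans (⊗-comm x 𝟙) (⊗-identityˡ x)

  ⊗-monoˡ : ∀ {x y} z → x ≤ y → x ⊗ z ≤ y ⊗ z
  ⊗-monoˡ z x≤y = adj₂ (≤-trans x≤y (adj₁ ≤-refl))

  ⊗-mono : ∀ {x y u v} → x ≤ y → u ≤ v → x ⊗ u ≤ y ⊗ v
  ⊗-mono {x} {y} {u} {v} x≤y u≤v = begin
    x ⊗ u  ≲⟨ ⊗-monoˡ u x≤y ⟩
    y ⊗ u  ≡⟨ ⊗-comm y u ⟩
    u ⊗ y  ≲⟨ ⊗-monoˡ y u≤v ⟩
    v ⊗ y  ≡⟨ ⊗-comm v y ⟩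
    y ⊗ v  ∎
    where open ≤-Reasoning

  ⋁-cong : ∀ {J : Set} {f g : J → Carrier} → (∀ j → f j ≡ g j) → ⋁ f ≡ ⋁ g
  ⋁-cong {f = f} {g} f≡g = ≤-antisym
    (⋁-lub f (λ j → ≤-trans (≡⇒≤ (f≡g j)) (⋁-ub g j)))
    (⋁-lub g (λ j → ≤-trans (≡⇒≤ (≡.sym (f≡g j))) (⋁-ub f j)))

  ⋀-cong : ∀ {J : Set} {f g : J → Carrier} → (∀ j → f j ≡ g j) → ⋀ f ≡ ⋀ g
  ⋀-cong {f = f} {g} f≡g = ≤-antisym
    (⋀-glb g (λ j → ≤-trans (⋀-lb f j) (≡⇒≤ (f≡g j))))
    (⋀-glb f (λ j → ≤-trans (⋀-lb g j) (≡⇒≤ (≡.sym (f≡g j)))))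

  ⇒-from-𝟙 : ∀ {x y z} → y ≡ 𝟙 → x ≤ y ⇒ z → x ≤ z
  ⇒-from-𝟙 {x} refl x≤𝟙⇒z = ≤-trans (≡⇒≤ (≡.sym (⊗-identityʳ x))) (adj₂ x≤𝟙⇒z)

  𝟙≤⇒ : ∀ {x y} → 𝟙 ≤ x ⇒ y → x ≤ y
  𝟙≤⇒ {x} 𝟙≤x⇒y = ≤-trans (≡⇒≤ (≡.sym (⊗-identityˡ x))) (adj₂ 𝟙≤x⇒y)

  ⟺-refl : ∀ x → 𝟙 ≤ x ⟺ x
  ⟺-refl x = ∧-glb 𝟙≤x⇒x 𝟙≤x⇒x
    where 𝟙≤x⇒x = adj₁ (≡⇒≤ (⊗-identityˡ x))

  ⟺-comm : ∀ x y → x ⟺ y ≡ y ⟺ x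
  ⟺-comm x y = ≤-antisym (∧-glb (∧-lb₂ _ _) (∧-lb₁ _ _)) (∧-glb (∧-lb₂ _ _) (∧-lb₁ _ _))

  𝟙≤⟺ : ∀ {x y} → 𝟙 ≤ x ⟺ y → x ≡ y
  𝟙≤⟺ 𝟙≤x⟺y = ≤-antisym (𝟙≤⇒ (≤-trans 𝟙≤x⟺y (∧-lb₁ _ _))) (𝟙≤⇒ (≤-trans 𝟙≤x⟺y (∧-lb₂ _ _)))

module RelationCalculus (L : CompleteResiduatedLattice) where
  open CompleteResiduatedLattice L renaming (_⇔_ to _⟺_)
  open FuzzyRel L
  open LatticeFacts L

  ⊑-preorder : (X Y : Set) → Preorder _ _ _
  ⊑-preorder X Y = record
    { Carrier = Rel X Y ; _≈_ = _≐_ ; _≲_ = _⊑_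
    ; isPreorder = record
      { isEquivalence = record
        { refl = λ _ _ → refl
        ; sym = λ P≐Q x y → ≡.sym (P≐Q x y)
        ; trans = λ P≐Q Q≐S x y → ≡.trans (P≐Q x y) (Q≐S x y) }
      ; reflexive = λ P≐Q x y → ≡⇒≤ (P≐Q x y)
      ; trans = λ P⊑Q Q⊑S x y → ≤-trans (P⊑Q x y) (Q⊑S x y) } }

  module ⊑-Reasoning {X Y : Set} = PreorderReasoning (⊑-preorder X Y)

  ∘-mono : ∀ {X Y Z} {P P' : Rel X Y} {Q Q' : Rel Y Z} → P ⊑ P' → Q ⊑ Q' → P ∘ Q ⊑ P' ∘ Q'
  ∘-mono {P' = P'} {Q' = Q'} P⊑P' Q⊑Q' x z =
    ⋁-lub _ (λ y → ≤-trans (⊗-mono (P⊑P' x y) (Q⊑Q' y z)) (⋁-ub (λ y → P' x y ⊗ Q' y z) y))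

  ∘-congˡ : ∀ {X Y Z} {P P' : Rel X Y} {Q : Rel Y Z} → P ≐ P' → P ∘ Q ≐ P' ∘ Q
  ∘-congˡ P≐P' x z = ⋁-cong (λ y → cong₂ _⊗_ (P≐P' x y) refl)

  ∘-congʳ : ∀ {X Y Z} {P : Rel X Y} {Q Q' : Rel Y Z} → Q ≐ Q' → P ∘ Q ≐ P ∘ Q'
  ∘-congʳ Q≐Q' x z = ⋁-cong (λ y → cong₂ _⊗_ refl (Q≐Q' y z))

  ∘-assoc : ∀ {X Y Z W} (P : Rel X Y) (Q : Rel Y Z) (S : Rel Z W) → (P ∘ Q) ∘ S ≐ P ∘ (Q ∘ S)
  ∘-assoc P Q S x w = ≤-antisym
    (⋁-lub _ λ z → adj₂ (⋁-lub _ λ y → adj₁ (begin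
      (P x y ⊗ Q y z) ⊗ S z w  ≡⟨ ⊗-assoc (P x y) (Q y z) (S z w) ⟩
      P x y ⊗ (Q y z ⊗ S z w)  ≲⟨ ⊗-mono ≤-refl (⋁-ub (λ z → Q y z ⊗ S z w) z) ⟩
      P x y ⊗ (Q ∘ S) y w      ≲⟨ ⋁-ub (λ y → P x y ⊗ (Q ∘ S) y w) y ⟩
      (P ∘ (Q ∘ S)) x w        ∎)))
    (⋁-lub _ λ y → ≤-trans (≡⇒≤ (⊗-comm (P x y) _)) (adj₂ (⋁-lub _ λ z → adj₁ (begin
      (Q y z ⊗ S z w) ⊗ P x y  ≡⟨ ⊗-comm (Q y z ⊗ S z w) (P x y) ⟩
      P x y ⊗ (Q y z ⊗ S z w)  ≡⟨ ⊗-assoc (P x y) (Q y z) (S z w) ⟨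
      (P x y ⊗ Q y z) ⊗ S z w  ≲⟨ ⊗-monoˡ (S z w) (⋁-ub (λ y → P x y ⊗ Q y z) y) ⟩
      (P ∘ Q) x z ⊗ S z w      ≲⟨ ⋁-ub (λ z → (P ∘ Q) x z ⊗ S z w) z ⟩
      ((P ∘ Q) ∘ S) x w        ∎))))
    where open ≤-Reasoning

  Reflexive : ∀ {X} → Rel X X → Set
  Reflexive E = ∀ x → 𝟙 ≤ E x x

  ⊑-∘ʳ : ∀ {X Y} {E : Rel Y Y} (S : Rel X Y) → Reflexive E → S ⊑ S ∘ E
  ⊑-∘ʳ {E = E} S E-refl x y = begin
    S x y         ≡⟨ ⊗-identityʳ (S x y) ⟨
    S x y ⊗ 𝟙     ≲⟨ ⊗-mono ≤-refl (E-refl y) ⟩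
    S x y ⊗ E y y ≲⟨ ⋁-ub (λ z → S x z ⊗ E z y) y ⟩
    (S ∘ E) x y   ∎
    where open ≤-Reasoning

  ⊑-∘ˡ : ∀ {X Y} {E : Rel X X} (S : Rel X Y) → Reflexive E → S ⊑ E ∘ S
  ⊑-∘ˡ {E = E} S E-refl x y = begin
    S x y         ≡⟨ ⊗-identityˡ (S x y) ⟨
    𝟙 ⊗ S x y     ≲⟨ ⊗-monoˡ (S x y) (E-refl x) ⟩
    E x x ⊗ S x y ≲⟨ ⋁-ub (λ z → E x z ⊗ S z y) x ⟩
    (E ∘ S) x y   ∎
    where open ≤-Reasoning

  ⊑-antisym : ∀ {X Y} {P Q : Rel X Y} → P ⊑ Q → Q ⊑ P → P ≐ Q
  ⊑-antisym P⊑Q Q⊑P x y = ≤-antisym (P⊑Q x y) (Q⊑P x y)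

  left-commutes⇔ : ∀ {X} {E V : Rel X X} → Reflexive E → E ∘ E ⊑ E →
                   (E ∘ V ⊑ V ∘ E) ⇔ ((E ∘ V) ∘ E ≐ V ∘ E)
  left-commutes⇔ {E = E} {V} E-refl E-trans = mk⇔ sandwich commute
    where
      open ⊑-Reasoning
      sandwich : E ∘ V ⊑ V ∘ E → (E ∘ V) ∘ E ≐ V ∘ E
      sandwich E∘V⊑V∘E = ⊑-antisym
        (begin
          (E ∘ V) ∘ E  ≲⟨ ∘-mono E∘V⊑V∘E (λ _ _ → ≤-refl) ⟩
          (V ∘ E) ∘ E  ≈⟨ ∘-assoc V E E ⟩
          V ∘ (E ∘ E)  ≲⟨ ∘-mono (λ _ _ → ≤-refl) E-trans ⟩
          V ∘ E        ∎)
        (begin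
          V ∘ E        ≲⟨ ⊑-∘ˡ (V ∘ E) E-refl ⟩
          E ∘ (V ∘ E)  ≈⟨ ∘-assoc E V E ⟨
          (E ∘ V) ∘ E  ∎)
      commute : (E ∘ V) ∘ E ≐ V ∘ E → E ∘ V ⊑ V ∘ E
      commute E∘V∘E≐V∘E = begin
        E ∘ V        ≲⟨ ⊑-∘ʳ (E ∘ V) E-refl ⟩
        (E ∘ V) ∘ E  ≈⟨ E∘V∘E≐V∘E ⟩
        V ∘ E        ∎

  right-commutes⇔ : ∀ {X} {F W : Rel X X} → Reflexive F → F ∘ F ⊑ F →
                    (W ∘ F ⊑ F ∘ W) ⇔ ((F ∘ W) ∘ F ≐ F ∘ W)
  right-commutes⇔ {F = F} {W} F-refl F-trans = mk⇔ sandwich commute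
    where
      open ⊑-Reasoning
      sandwich : W ∘ F ⊑ F ∘ W → (F ∘ W) ∘ F ≐ F ∘ W
      sandwich W∘F⊑F∘W = ⊑-antisym
        (begin
          (F ∘ W) ∘ F  ≈⟨ ∘-assoc F W F ⟩
          F ∘ (W ∘ F)  ≲⟨ ∘-mono (λ _ _ → ≤-refl) W∘F⊑F∘W ⟩
          F ∘ (F ∘ W)  ≈⟨ ∘-assoc F F W ⟨
          (F ∘ F) ∘ W  ≲⟨ ∘-mono F-trans (λ _ _ → ≤-refl) ⟩
          F ∘ W        ∎)
        (⊑-∘ʳ (F ∘ W) F-refl)
      commute : (F ∘ W) ∘ F ≐ F ∘ W → W ∘ F ⊑ F ∘ W
      commute F∘W∘F≐F∘W = begin
        W ∘ F        ≲⟨ ⊑-∘ˡ (W ∘ F) F-refl ⟩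
        F ∘ (W ∘ F)  ≈⟨ ∘-assoc F W F ⟨
        (F ∘ W) ∘ F  ≈⟨ F∘W∘F≐F∘W ⟩
        F ∘ W        ∎

  WL1-4-of-symmetric : ∀ {X I} {T : I → Rel X X} {W U : Rel X X} → U ⁻¹ ≐ U →
                       (∀ i → U ∘ T i ⊑ T i ∘ U) → U ⊑ W → WL1-4 T W U
  WL1-4-of-symmetric {T = T} {W} {U} U-sym U∘T⊑T∘U U⊑W =
    U∘T⊑T∘U , U⁻¹∘T⊑T∘U⁻¹ , U⊑W , (begin U ⁻¹ ≈⟨ U-sym ⟩ U ≲⟨ U⊑W ⟩ W ∎)
    where
      open ⊑-Reasoning
      U⁻¹∘T⊑T∘U⁻¹ : ∀ i → U ⁻¹ ∘ T i ⊑ T i ∘ U ⁻¹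
      U⁻¹∘T⊑T∘U⁻¹ i = begin
        U ⁻¹ ∘ T i  ≈⟨ ∘-congˡ U-sym ⟩
        U ∘ T i     ≲⟨ U∘T⊑T∘U i ⟩
        T i ∘ U     ≈⟨ ∘-congʳ U-sym ⟨
        T i ∘ U ⁻¹  ∎

  WL1-5-of-symmetric : ∀ {X I} {T : I → Rel X X} {W U : Rel X X} → U ⁻¹ ≐ U →
                       (∀ i → T i ∘ U ⊑ U ∘ T i) → U ⊑ W → WL1-5 T W U
  WL1-5-of-symmetric {T = T} {W} {U} U-sym T∘U⊑U∘T U⊑W =
    T∘U⊑U∘T , T∘U⁻¹⊑U⁻¹∘T , U⊑W , (begin U ⁻¹ ≈⟨ U-sym ⟩ U ≲⟨ U⊑W ⟩ W ∎)
    where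
      open ⊑-Reasoning
      T∘U⁻¹⊑U⁻¹∘T : ∀ i → T i ∘ U ⁻¹ ⊑ U ⁻¹ ∘ T i
      T∘U⁻¹⊑U⁻¹∘T i = begin
        T i ∘ U ⁻¹  ≈⟨ ∘-congʳ U-sym ⟩
        T i ∘ U     ≲⟨ T∘U⊑U∘T i ⟩
        U ∘ T i     ≈⟨ ∘-congˡ U-sym ⟨
        U ⁻¹ ∘ T i  ∎

-- The kernel of an arbitrary fuzzy relation.  Since kerB R is definitionally
-- kerA (R ⁻¹), every fact below also applies to co-kernels.
module Kernel (L : CompleteResiduatedLattice) where
  open CompleteResiduatedLattice L renaming (_⇔_ to _⟺_)
  open FuzzyRel L
  open LatticeFacts L
  open RelationCalculus L

  kerA-refl : ∀ {A B} (R : Rel A B) → Reflexive (kerA R)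
  kerA-refl R a = ⋀-glb _ (λ b → ⟺-refl (R a b))

  kerA-sym : ∀ {A B} (R : Rel A B) → kerA R ⁻¹ ≐ kerA R
  kerA-sym R a₁ a₂ = ⋀-cong (λ b → ⟺-comm (R a₂ b) (R a₁ b))

  kerA-𝟙 : ∀ {A B} (R : Rel A B) {a₁ a₂} → 𝟙 ≤ kerA R a₁ a₂ → ∀ b → R a₁ b ≡ R a₂ b
  kerA-𝟙 R 𝟙≤ker b = 𝟙≤⟺ (≤-trans 𝟙≤ker (⋀-lb _ b))

  kerA⊑R∘R⁻¹ : ∀ {A B} (R : Rel A B) → (∀ a → Σ B λ b → R a b ≡ 𝟙) → kerA R ⊑ R ∘ R ⁻¹
  kerA⊑R∘R⁻¹ {B = B} R total a a' = begin
    kerA R a a'      ≲⟨ ⇒-from-𝟙 R[a',b]≡𝟙 (≤-trans (⋀-lb _ b) (∧-lb₂ _ _)) ⟩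
    R a b            ≡⟨ ⊗-identityʳ (R a b) ⟨
    R a b ⊗ 𝟙        ≡⟨ cong (R a b ⊗_) R[a',b]≡𝟙 ⟨
    R a b ⊗ R a' b   ≲⟨ ⋁-ub (λ b → R a b ⊗ R a' b) b ⟩
    (R ∘ R ⁻¹) a a'  ∎
    where
      open ≤-Reasoning
      b : B
      b = proj₁ (total a')
      R[a',b]≡𝟙 : R a' b ≡ 𝟙
      R[a',b]≡𝟙 = proj₂ (total a')

module UniformRelation (L : CompleteResiduatedLattice) {A B : Set}
                       {R : FuzzyRel.Rel L A B} (uR : FuzzyRel.IsUniform L R) where
  open CompleteResiduatedLattice L renaming (_⇔_ to _⟺_)
  open FuzzyRel L
  open LatticeFacts L
  open RelationCalculus L
  open Kernel L
  open IsUniform uR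

  E : Rel A A
  E = kerA R

  F : Rel B B
  F = kerB R

  E-compatible : ∀ a₁ a₂ b → R a₁ b ⊗ E a₁ a₂ ≤ R a₂ b
  E-compatible = proj₁ partial

  F-compatible : ∀ a b₁ b₂ → R a b₁ ⊗ F b₁ b₂ ≤ R a b₂
  F-compatible = proj₁ (proj₂ partial)

  functional : ∀ a b₁ b₂ → R a b₁ ⊗ R a b₂ ≤ F b₁ b₂
  functional = proj₂ (proj₂ partial)

  E-refl : Reflexive E
  E-refl = kerA-refl R

  F-refl : Reflexive F
  F-refl = kerA-refl (R ⁻¹)

  E-sym : E ⁻¹ ≐ E
  E-sym = kerA-sym R

  F-sym : F ⁻¹ ≐ F
  F-sym = kerA-sym (R ⁻¹)

  R∘R⁻¹≐E : R ∘ R ⁻¹ ≐ E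
  R∘R⁻¹≐E = ⊑-antisym R∘R⁻¹⊑E (kerA⊑R∘R⁻¹ R left)
    where
      open ≤-Reasoning
      transfer : ∀ a a' b c → (R a b ⊗ R a' b) ⊗ R a c ≤ R a' c
      transfer a a' b c = begin
        (R a b ⊗ R a' b) ⊗ R a c  ≡⟨ cong (_⊗ R a c) (⊗-comm (R a b) (R a' b)) ⟩
        (R a' b ⊗ R a b) ⊗ R a c  ≡⟨ ⊗-assoc (R a' b) (R a b) (R a c) ⟩
        R a' b ⊗ (R a b ⊗ R a c)  ≲⟨ ⊗-mono ≤-refl (functional a b c) ⟩
        R a' b ⊗ F b c            ≲⟨ F-compatible a' b c ⟩
        R a' c                    ∎
      R∘R⁻¹⊑E : R ∘ R ⁻¹ ⊑ E
      R∘R⁻¹⊑E a a' = ⋁-lub _ λ b → ⋀-glb _ λ c → ∧-glb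
        (adj₁ (transfer a a' b c))
        (adj₁ (≤-trans (≡⇒≤ (cong (_⊗ R a' c) (⊗-comm (R a b) (R a' b)))) (transfer a' a b c)))

  R⁻¹∘R≐F : R ⁻¹ ∘ R ≐ F
  R⁻¹∘R≐F = ⊑-antisym (λ b₁ b₂ → ⋁-lub _ λ a → functional a b₁ b₂) (kerA⊑R∘R⁻¹ (R ⁻¹) right)

  E∘R≐R : E ∘ R ≐ R
  E∘R≐R = ⊑-antisym E∘R⊑R (⊑-∘ˡ R E-refl)
    where
      E∘R⊑R : E ∘ R ⊑ R
      E∘R⊑R a b = ⋁-lub _ λ a₁ → ≤-trans
        (≡⇒≤ (≡.trans (⊗-comm (E a a₁) (R a₁ b)) (cong (R a₁ b ⊗_) (E-sym a₁ a))))
        (E-compatible a₁ a b)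

  R∘F≐R : R ∘ F ≐ R
  R∘F≐R = ⊑-antisym (λ a b → ⋁-lub _ λ b₁ → F-compatible a b₁ b) (⊑-∘ʳ R F-refl)

  E-trans : E ∘ E ⊑ E
  E-trans = begin
    E ∘ E               ≈⟨ ∘-congʳ R∘R⁻¹≐E ⟨
    E ∘ (R ∘ R ⁻¹)      ≈⟨ ∘-assoc E R (R ⁻¹) ⟨
    (E ∘ R) ∘ R ⁻¹      ≈⟨ ∘-congˡ E∘R≐R ⟩
    R ∘ R ⁻¹            ≈⟨ R∘R⁻¹≐E ⟩
    E                   ∎
    where open ⊑-Reasoning

  F-trans : F ∘ F ⊑ F
  F-trans = begin
    F ∘ F               ≈⟨ ∘-congˡ R⁻¹∘R≐F ⟨
    (R ⁻¹ ∘ R) ∘ F      ≈⟨ ∘-assoc (R ⁻¹) R F ⟩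
    R ⁻¹ ∘ (R ∘ F)      ≈⟨ ∘-congʳ R∘F≐R ⟩
    R ⁻¹ ∘ R            ≈⟨ R⁻¹∘R≐F ⟩
    F                   ∎
    where open ⊑-Reasoning

  row-at-𝟙 : ∀ {a b} → R a b ≡ 𝟙 → ∀ c → R a c ≡ F b c
  row-at-𝟙 {a} {b} R[a,b]≡𝟙 c = ≤-antisym
    (begin
      R a c          ≡⟨ ⊗-identityˡ (R a c) ⟨
      𝟙 ⊗ R a c      ≡⟨ cong (_⊗ R a c) R[a,b]≡𝟙 ⟨
      R a b ⊗ R a c  ≲⟨ functional a b c ⟩
      F b c          ∎)
    (begin
      F b c          ≡⟨ ⊗-identityˡ (F b c) ⟨
      𝟙 ⊗ F b c      ≡⟨ cong (_⊗ F b c) R[a,b]≡𝟙 ⟨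
      R a b ⊗ F b c  ≲⟨ F-compatible a b c ⟩
      R a c          ∎)
    where open ≤-Reasoning

  R≡F[ψ] : ∀ a c → R a c ≡ F (ψ a) c
  R≡F[ψ] a = row-at-𝟙 (proj₂ (left a))

  conjugate : (S : Rel B B) → ∀ a₁ a₂ → ((R ∘ S) ∘ R ⁻¹) a₁ a₂ ≡ ((F ∘ S) ∘ F) (ψ a₁) (ψ a₂)
  conjugate S a₁ a₂ = ⋁-cong λ b → cong₂ _⊗_
    (⋁-cong λ b' → cong (_⊗ S b' b) (R≡F[ψ] a₁ b'))
    (≡.trans (R≡F[ψ] a₂ b) (F-sym b (ψ a₂)))

  ψ-well-defined : ∀ a a' → SameClass E a a' → SameClass F (ψ a) (ψ a')
  ψ-well-defined a a' [a]≡[a'] b = begin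
    F (ψ a) b   ≡⟨ R≡F[ψ] a b ⟨
    R a b       ≡⟨ kerA-𝟙 R 𝟙≤E[a,a'] b ⟩
    R a' b      ≡⟨ R≡F[ψ] a' b ⟩
    F (ψ a') b  ∎
    where
      open ≡.≡-Reasoning
      𝟙≤E[a,a'] : 𝟙 ≤ E a a'
      𝟙≤E[a,a'] = ≤-trans (E-refl a') (≡⇒≤ (≡.sym ([a]≡[a'] a')))

  ψ-injective : ∀ a a' → SameClass F (ψ a) (ψ a') → SameClass E a a'
  ψ-injective a a' [ψa]≡[ψa'] a'' = ⋀-cong λ b → cong (_⟺ R a'' b)
    (≡.trans (R≡F[ψ] a b) (≡.trans ([ψa]≡[ψa'] b) (≡.sym (R≡F[ψ] a' b))))

  ψ-surjective : ∀ b → Σ A λ a → SameClass F (ψ a) b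
  ψ-surjective b = a , λ c → ≡.trans (≡.sym (R≡F[ψ] a c)) (row-at-𝟙 R[a,b]≡𝟙 c)
    where
      a : A
      a = proj₁ (right b)
      R[a,b]≡𝟙 : R a b ≡ 𝟙
      R[a,b]≡𝟙 = proj₂ (right b)

  quotient-iso⇔ : ∀ {I} (V : I → Rel A A) (W : I → Rel B B) →
                  IsQuotientIso V E W F ψ ⇔ (∀ i → (E ∘ V i) ∘ E ≐ (R ∘ W i) ∘ R ⁻¹)
  quotient-iso⇔ V W = mk⇔
    (λ iso i a₁ a₂ → ≡.trans (IsQuotientIso.preserves iso i a₁ a₂) (≡.sym (conjugate (W i) a₁ a₂)))
    (λ E∘V∘E≐R∘W∘R⁻¹ → record
      { well-defined = ψ-well-defined
      ; injective    = ψ-injective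
      ; surjective   = ψ-surjective
      ; preserves    = λ i a₁ a₂ → ≡.trans (E∘V∘E≐R∘W∘R⁻¹ i a₁ a₂) (conjugate (W i) a₁ a₂) })

  intertwines⇔ : (V : Rel A A) (W : Rel B B) →
                 (V ∘ R ≐ R ∘ W) ⇔
                 (((E ∘ V) ∘ E ≐ V ∘ E) × ((E ∘ V) ∘ E ≐ (R ∘ W) ∘ R ⁻¹) × ((F ∘ W) ∘ F ≐ F ∘ W))
  intertwines⇔ V W = mk⇔ sandwiches intertwines
    where
      open ⊑-Reasoning
      sandwiches : V ∘ R ≐ R ∘ W →
                   ((E ∘ V) ∘ E ≐ V ∘ E) × ((E ∘ V) ∘ E ≐ (R ∘ W) ∘ R ⁻¹) × ((F ∘ W) ∘ F ≐ F ∘ W)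
      sandwiches V∘R≐R∘W = E∘V∘E≐V∘E , E∘V∘E≐R∘W∘R⁻¹ , F∘W∘F≐F∘W
        where
          V∘E≐R∘W∘R⁻¹ : V ∘ E ≐ (R ∘ W) ∘ R ⁻¹
          V∘E≐R∘W∘R⁻¹ = begin-equality
            V ∘ E                ≈⟨ ∘-congʳ R∘R⁻¹≐E ⟨
            V ∘ (R ∘ R ⁻¹)       ≈⟨ ∘-assoc V R (R ⁻¹) ⟨
            (V ∘ R) ∘ R ⁻¹       ≈⟨ ∘-congˡ V∘R≐R∘W ⟩
            (R ∘ W) ∘ R ⁻¹       ∎
          E∘V∘E≐R∘W∘R⁻¹ : (E ∘ V) ∘ E ≐ (R ∘ W) ∘ R ⁻¹
          E∘V∘E≐R∘W∘R⁻¹ = begin-equality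
            (E ∘ V) ∘ E          ≈⟨ ∘-assoc E V E ⟩
            E ∘ (V ∘ E)          ≈⟨ ∘-congʳ V∘E≐R∘W∘R⁻¹ ⟩
            E ∘ ((R ∘ W) ∘ R ⁻¹) ≈⟨ ∘-assoc E (R ∘ W) (R ⁻¹) ⟨
            (E ∘ (R ∘ W)) ∘ R ⁻¹ ≈⟨ ∘-congˡ (∘-assoc E R W) ⟨
            ((E ∘ R) ∘ W) ∘ R ⁻¹ ≈⟨ ∘-congˡ (∘-congˡ E∘R≐R) ⟩
            (R ∘ W) ∘ R ⁻¹       ∎
          E∘V∘E≐V∘E : (E ∘ V) ∘ E ≐ V ∘ E
          E∘V∘E≐V∘E = begin-equality
            (E ∘ V) ∘ E          ≈⟨ E∘V∘E≐R∘W∘R⁻¹ ⟩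
            (R ∘ W) ∘ R ⁻¹       ≈⟨ V∘E≐R∘W∘R⁻¹ ⟨
            V ∘ E                ∎
          F∘W≐R⁻¹∘V∘R : F ∘ W ≐ R ⁻¹ ∘ (V ∘ R)
          F∘W≐R⁻¹∘V∘R = begin-equality
            F ∘ W                ≈⟨ ∘-congˡ R⁻¹∘R≐F ⟨
            (R ⁻¹ ∘ R) ∘ W       ≈⟨ ∘-assoc (R ⁻¹) R W ⟩
            R ⁻¹ ∘ (R ∘ W)       ≈⟨ ∘-congʳ V∘R≐R∘W ⟨
            R ⁻¹ ∘ (V ∘ R)       ∎
          F∘W∘F≐F∘W : (F ∘ W) ∘ F ≐ F ∘ W
          F∘W∘F≐F∘W = begin-equality
            (F ∘ W) ∘ F          ≈⟨ ∘-congˡ F∘W≐R⁻¹∘V∘R ⟩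
            (R ⁻¹ ∘ (V ∘ R)) ∘ F ≈⟨ ∘-assoc (R ⁻¹) (V ∘ R) F ⟩
            R ⁻¹ ∘ ((V ∘ R) ∘ F) ≈⟨ ∘-congʳ (∘-assoc V R F) ⟩
            R ⁻¹ ∘ (V ∘ (R ∘ F)) ≈⟨ ∘-congʳ (∘-congʳ R∘F≐R) ⟩
            R ⁻¹ ∘ (V ∘ R)       ≈⟨ F∘W≐R⁻¹∘V∘R ⟨
            F ∘ W                ∎
      intertwines : ((E ∘ V) ∘ E ≐ V ∘ E) × ((E ∘ V) ∘ E ≐ (R ∘ W) ∘ R ⁻¹) × ((F ∘ W) ∘ F ≐ F ∘ W) →
                    V ∘ R ≐ R ∘ W
      intertwines (E∘V∘E≐V∘E , E∘V∘E≐R∘W∘R⁻¹ , F∘W∘F≐F∘W) = begin-equality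
        V ∘ R                  ≈⟨ ∘-congʳ E∘R≐R ⟨
        V ∘ (E ∘ R)            ≈⟨ ∘-assoc V E R ⟨
        (V ∘ E) ∘ R            ≈⟨ ∘-congˡ E∘V∘E≐V∘E ⟨
        ((E ∘ V) ∘ E) ∘ R      ≈⟨ ∘-congˡ E∘V∘E≐R∘W∘R⁻¹ ⟩
        ((R ∘ W) ∘ R ⁻¹) ∘ R   ≈⟨ ∘-assoc (R ∘ W) (R ⁻¹) R ⟩
        (R ∘ W) ∘ (R ⁻¹ ∘ R)   ≈⟨ ∘-congʳ R⁻¹∘R≐F ⟩
        (R ∘ W) ∘ F            ≈⟨ ∘-congˡ (∘-congˡ R∘F≐R) ⟨
        ((R ∘ F) ∘ W) ∘ F      ≈⟨ ∘-congˡ (∘-assoc R F W) ⟩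
        (R ∘ (F ∘ W)) ∘ F      ≈⟨ ∘-assoc R (F ∘ W) F ⟩
        R ∘ ((F ∘ W) ∘ F)      ≈⟨ ∘-congʳ F∘W∘F≐F∘W ⟩
        R ∘ (F ∘ W)            ≈⟨ ∘-assoc R F W ⟨
        (R ∘ F) ∘ W            ≈⟨ ∘-congˡ R∘F≐R ⟩
        R ∘ W                  ∎

  E⊑Z∘Z⁻¹ : ∀ {Z : Rel A B} → R ⊑ Z → E ⊑ Z ∘ Z ⁻¹
  E⊑Z∘Z⁻¹ {Z} R⊑Z = begin
    E        ≈⟨ R∘R⁻¹≐E ⟨
    R ∘ R ⁻¹ ≲⟨ ∘-mono R⊑Z (λ b a → R⊑Z a b) ⟩
    Z ∘ Z ⁻¹ ∎
    where open ⊑-Reasoning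

  F⊑Z⁻¹∘Z : ∀ {Z : Rel A B} → R ⊑ Z → F ⊑ Z ⁻¹ ∘ Z
  F⊑Z⁻¹∘Z {Z} R⊑Z = begin
    F        ≈⟨ R⁻¹∘R≐F ⟨
    R ⁻¹ ∘ R ≲⟨ ∘-mono (λ b a → R⊑Z a b) R⊑Z ⟩
    Z ⁻¹ ∘ Z ∎
    where open ⊑-Reasoning

theorem7p4 : (L : CompleteResiduatedLattice) →
    let open FuzzyRel L in
    {A B I : Set} → A → B → I →
    (V : I → Rel A A) (W : I → Rel B B) (R Z : Rel A B) →
    (uR : IsUniform R) → R ⊑ Z →
    WL2-5 V W Z R ⇔
      (WL1-4 V (Z ∘ (Z ⁻¹)) (kerA R) ×
       WL1-5 W ((Z ⁻¹) ∘ Z) (kerB R) ×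
       IsQuotientIso V (kerA R) W (kerB R) (IsUniform.ψ uR))
theorem7p4 L _ _ _ V W R Z uR R⊑Z = mk⇔ forward backward
  where
    open FuzzyRel L
    open RelationCalculus L
    open UniformRelation L uR
    open IsUniform uR using (ψ)
    open Equivalence

    E-commutes⇔ : ∀ i → (E ∘ V i ⊑ V i ∘ E) ⇔ ((E ∘ V i) ∘ E ≐ V i ∘ E)
    E-commutes⇔ i = left-commutes⇔ E-refl E-trans

    F-commutes⇔ : ∀ i → (W i ∘ F ⊑ F ∘ W i) ⇔ ((F ∘ W i) ∘ F ≐ F ∘ W i)
    F-commutes⇔ i = right-commutes⇔ F-refl F-trans

    forward : WL2-5 V W Z R → WL1-4 V (Z ∘ Z ⁻¹) E × WL1-5 W (Z ⁻¹ ∘ Z) F × IsQuotientIso V E W F ψ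
    forward (V∘R≐R∘W , _) =
        WL1-4-of-symmetric E-sym (λ i → from (E-commutes⇔ i) (proj₁ (sandwiches i))) (E⊑Z∘Z⁻¹ R⊑Z)
      , WL1-5-of-symmetric F-sym (λ i → from (F-commutes⇔ i) (proj₂ (proj₂ (sandwiches i)))) (F⊑Z⁻¹∘Z R⊑Z)
      , from (quotient-iso⇔ V W) (λ i → proj₁ (proj₂ (sandwiches i)))
      where
        sandwiches : ∀ i → ((E ∘ V i) ∘ E ≐ V i ∘ E) × ((E ∘ V i) ∘ E ≐ (R ∘ W i) ∘ R ⁻¹) ×
                           ((F ∘ W i) ∘ F ≐ F ∘ W i)
        sandwiches i = to (intertwines⇔ (V i) (W i)) (V∘R≐R∘W i)

    backward : WL1-4 V (Z ∘ Z ⁻¹) E × WL1-5 W (Z ⁻¹ ∘ Z) F × IsQuotientIso V E W F ψ → WL2-5 V W Z R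
    backward ((E∘V⊑V∘E , _) , (W∘F⊑F∘W , _) , iso) = V∘R≐R∘W , R⊑Z
      where
        V∘R≐R∘W : ∀ i → V i ∘ R ≐ R ∘ W i
        V∘R≐R∘W i = from (intertwines⇔ (V i) (W i))
          ( to (E-commutes⇔ i) (E∘V⊑V∘E i)
          , to (quotient-iso⇔ V W) iso i
          , to (F-commutes⇔ i) (W∘F⊑F∘W i) )
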